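{- Let $G$ be a connected bipartite graph on $n\geq 5$ vertices which does not have any twins of degree $2$ or greater, i.e. there is no pair of distinct vertices $u,v$, each of degree at least $2$, with $N(u)=N(v)$ or $N[u]=N[v]$. Then $\gamma^{\mathrm{ID}}(G)\leq \min\left\{\frac{n+\ell(G)}{2},\, n-s(G)\right\}$.
   Context: All graphs are finite, simple and undirected. $N(v)$ and $N[v]$ denote the open and closed neighbourhoods of $v$. A leaf is a vertex of degree $1$; a support vertex is a vertex adjacent to a leaf; $\ell(G)$ and $s(G)$ are the numbers of leaves and support vertices of $G$. A set $C\subseteq V(G)$ is an identifying code if for every vertex $v$ the set $N[v]\cap C$ is nonempty and for every two distinct vertices $u,v$ we have $N[u]\cap C\neq N[v]\cap C$. $\gamma^{\mathrm{ID}}(G)$ is the minimum size of an identifying code of $G$. -}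

module Defs where

open import Data.Nat using (ℕ; zero; suc; _+_; _≤_)
open import Data.Bool using (Bool; true; false; _∧_; _∨_; if_then_else_)
open import Data.Fin using (Fin; _≟_)
open import Data.List using (List; map)
open import Data.Nat.ListAction using (sum)
open import Data.Bool.ListAction using (any)
open import Data.Fin.Base using ()
open import Data.List using (allFin)
open import Data.Product using (Σ; _×_; ∃)
open import Relation.Nullary using (¬_)
open import Relation.Nullary.Decidable using (⌊_⌋)
open import Relation.Binary.PropositionalEquality using (_≡_; _≢_)

record Graph (n : ℕ) : Set where
  field
    adj   : Fin n → Fin n → Bool
    sym   : ∀ u v → adj u v ≡ adj v u
    irref : ∀ v → adj v v ≡ false
open Graph public

count : {n : ℕ} → (Fin n → Bool) → ℕ
count {n} p = sum (map (λ i → if p i then 1 else 0) (allFin n))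

module _ {n : ℕ} (G : Graph n) where

  degree : Fin n → ℕ
  degree v = count (adj G v)

  closedNbr : Fin n → Fin n → Bool
  closedNbr v w = ⌊ v ≟ w ⌋ ∨ adj G v w

  isLeaf : Fin n → Bool
  isLeaf v = ⌊ degree v Data.Nat.≟ 1 ⌋

  isSupport : Fin n → Bool
  isSupport v = any (λ u → adj G v u ∧ isLeaf u) (allFin n)

  numLeaves : ℕ
  numLeaves = count isLeaf

  numSupport : ℕ
  numSupport = count isSupport

  data Reachable : Fin n → Fin n → Set where
    here  : ∀ {v} → Reachable v v
    step  : ∀ {u v w} → adj G u v ≡ true → Reachable v w → Reachable u w

  Connected : Set
  Connected = ∀ u v → Reachable u v

  Bipartite : Set
  Bipartite = Σ (Fin n → Bool) λ c → ∀ u v → adj G u v ≡ true → c u ≢ c v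

  NoTwinsDeg2 : Set
  NoTwinsDeg2 = ∀ u v → u ≢ v → 2 ≤ degree u → 2 ≤ degree v →
                ¬ (∀ w → adj G u w ≡ adj G v w) × ¬ (∀ w → closedNbr u w ≡ closedNbr v w)

  IdentifyingCode : (Fin n → Bool) → Set
  IdentifyingCode C =
    (∀ v → ∃ λ w → closedNbr v w ∧ C w ≡ true) ×
    (∀ u v → u ≢ v → ¬ (∀ w → closedNbr u w ∧ C w ≡ closedNbr v w ∧ C w))

module Submission where

-- The codes are complements V ∖ S of sets S that are independent, contain no two open twins,
-- and leave, for every edge uv, a neighbour of u other than v or a neighbour of v other than u
-- outside S; in a triangle-free graph without isolated vertices every such complement is
-- identifying. Taking for S one leaf at each support vertex gives a code of size at most n − s(G).
-- Taking for S a colour class minus a set R of claimed vertices (at each support vertex all its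
-- leaves but one, plus one further neighbour) gives two codes of total size n + |R| ≤ n + ℓ(G).
-- The smallest of the three codes satisfies both bounds.

open import Defs hiding (sym)
open import Data.Bool using (Bool; true; false; _∧_; _∨_; not; if_then_else_)
import Data.Bool.Properties as Bool
open import Data.Bool.Properties
  using (T-≡; ∧-identityʳ; ∧-zeroʳ; ∨-zeroʳ; ∨-inverseˡ; ∧-inverseˡ; ∧-conicalˡ; ∧-conicalʳ;
         ¬-not; not-injective)
open import Data.Bool.ListAction using (any)
open import Data.Empty using (⊥)
open import Data.Fin using (Fin; zero; suc; _≟_)
open import Data.Fin.Properties using (any?; pigeonhole)
import Data.Fin.Properties as Fin
open import Data.List using (List; []; _∷_; [_]; allFin; tabulate; length; lookup)
open import Data.List.Properties using (map-tabulate)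
open import Data.List.Membership.Propositional using (_∈_; lose)
open import Data.List.Membership.Propositional.Properties using (∈-allFin)
import Data.List.Relation.Unary.Any as Any
open import Data.List.Relation.Unary.Any using (here; there)
open import Data.List.Relation.Unary.Any.Properties using (any⁺; any⁻; lookup-index)
import Data.Nat as ℕ
open import Data.Nat using (ℕ; zero; suc; _+_; _*_; _≤_; _≤?_; z≤n; s≤s)
import Data.Nat.ListAction as List
open import Data.Nat.Properties
  using (+-comm; +-identityʳ; +-suc; +-mono-≤; +-monoˡ-≤; +-monoʳ-≤; *-monoʳ-≤; m≤m+n; ≤-trans;
         ≤-reflexive; <⇒≤; ≰⇒>; ≮⇒≥; <⇒≱; ≤∧≮⇒≡; n≢0⇒n>0; suc-injective; +-0-commutativeMonoid;
         module ≤-Reasoning)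
open import Algebra.Properties.CommutativeMonoid.Sum +-0-commutativeMonoid
  using (sum; sum-syntax; sum-cong-≗; ∑-comm; ∑-distrib-+)
open import Data.Product using (Σ; _×_; _,_; proj₁; proj₂; ∃; uncurry)
open import Data.Sum using (_⊎_; inj₁; inj₂)
import Data.Sum as Sum
open import Function using (_∘_; id)
open import Function.Bundles using (Equivalence)
open import Relation.Binary.PropositionalEquality
  using (_≡_; _≢_; refl; sym; trans; cong; cong₂; subst; ≢-sym; module ≡-Reasoning)
open import Relation.Nullary using (¬_; ¬?; Dec; yes; no; contradiction; _×-dec_)
open import Relation.Nullary.Decidable using (⌊_⌋)

private variable
  m n : ℕ
  p q : Fin n → Bool

toℕ : Bool → ℕ
toℕ b = if b then 1 else 0

_-_ : (Fin n → Bool) → Fin n → Fin n → Bool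
(p - a) x = p x ∧ not ⌊ x ≟ a ⌋

⌊≟⌋⇒≡ : {x a : Fin n} → ⌊ x ≟ a ⌋ ≡ true → x ≡ a
⌊≟⌋⇒≡ {x = x} {a} _ with x ≟ a
... | yes x≡a = x≡a

⌊≟⌋-refl : (x : Fin n) → ⌊ x ≟ x ⌋ ≡ true
⌊≟⌋-refl x with x ≟ x
... | yes _   = refl
... | no  x≢x = contradiction refl x≢x

⌊≟⌋-≢ : {x a : Fin n} → x ≢ a → ⌊ x ≟ a ⌋ ≡ false
⌊≟⌋-≢ {x = x} {a} x≢a with x ≟ a
... | yes x≡a = contradiction x≡a x≢a
... | no  _   = refl

⌊suc≟suc⌋ : (x a : Fin n) → ⌊ suc x ≟ suc a ⌋ ≡ ⌊ x ≟ a ⌋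
⌊suc≟suc⌋ x a with x ≟ a
... | yes _ = refl
... | no  _ = refl

remove-intro : ∀ {x a} → p x ≡ true → x ≢ a → (p - a) x ≡ true
remove-intro px x≢a rewrite px | ⌊≟⌋-≢ x≢a = refl

remove-elim : ∀ {x a} → (p - a) x ≡ true → p x ≡ true × x ≢ a
remove-elim {p = p} {x} {a} px∧x≢a with p x | x ≟ a
... | true | no x≢a = refl , x≢a

∧-intro : {a b : Bool} → a ≡ true → b ≡ true → a ∧ b ≡ true
∧-intro refl refl = refl

≢-≢⇒≡ : {a b c : Bool} → a ≢ b → b ≢ c → a ≡ c
≢-≢⇒≡ a≢b b≢c = trans (¬-not a≢b) (sym (¬-not (≢-sym b≢c)))

any-allFin⁻ : (p : Fin n → Bool) → any p (allFin n) ≡ true → ∃ λ x → p x ≡ true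
any-allFin⁻ {n} p any-p =
  let x , px = Any.satisfied (any⁻ p (allFin n) (Equivalence.from T-≡ any-p)) in x , Equivalence.to T-≡ px

any-allFin⁺ : (p : Fin n → Bool) → ∀ {x} → p x ≡ true → any p (allFin n) ≡ true
any-allFin⁺ p {x} px = Equivalence.to T-≡ (any⁺ p (lose (∈-allFin x) (Equivalence.from T-≡ px)))

choose : (Fin n → Bool) → Fin n → Fin n
choose p default with any? (λ x → p x Bool.≟ true)
... | yes (x , _) = x
... | no  _       = default

choose-spec : (p : Fin n → Bool) (default : Fin n) →
              p (choose p default) ≡ true ⊎ (choose p default ≡ default × ∀ x → p x ≢ true)
choose-spec p default with any? (λ x → p x Bool.≟ true)
... | yes (_ , px) = inj₁ px
... | no  ∄x       = inj₂ (refl , λ x px → ∄x (x , px))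

∑-mono-≤ : {f g : Fin n → ℕ} → (∀ x → f x ≤ g x) → sum f ≤ sum g
∑-mono-≤ {zero}  f≤g = z≤n
∑-mono-≤ {suc n} f≤g = +-mono-≤ (f≤g zero) (∑-mono-≤ (f≤g ∘ suc))

sum-tabulate : (f : Fin n → ℕ) → List.sum (tabulate f) ≡ sum f
sum-tabulate {zero}  f = refl
sum-tabulate {suc n} f = cong (f zero +_) (sum-tabulate (f ∘ suc))

count-∑ : (p : Fin n → Bool) → count p ≡ ∑[ x < n ] toℕ (p x)
count-∑ p = trans (cong List.sum (map-tabulate id (toℕ ∘ p))) (sum-tabulate (toℕ ∘ p))

count-suc : (p : Fin (suc n) → Bool) → count p ≡ toℕ (p zero) + count (p ∘ suc)
count-suc p = trans (count-∑ p) (cong (toℕ (p zero) +_) (sym (count-∑ (p ∘ suc))))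

count-cong : (∀ x → p x ≡ q x) → count p ≡ count q
count-cong {p = p} {q} p≗q = begin
  count p                ≡⟨ count-∑ p ⟩
  ∑[ x < _ ] toℕ (p x)   ≡⟨ sum-cong-≗ (cong toℕ ∘ p≗q) ⟩
  ∑[ x < _ ] toℕ (q x)   ≡⟨ count-∑ q ⟨
  count q                ∎
  where open ≡-Reasoning

count-true : count (λ (_ : Fin n) → true) ≡ n
count-true {zero}  = refl
count-true {suc n} = trans (count-suc {n} (λ _ → true)) (cong suc count-true)

count-empty : (∀ x → ¬ p x ≡ true) → count p ≡ 0
count-empty {zero}      _     = refl
count-empty {suc n} {p} empty = begin
  count p                          ≡⟨ count-suc p ⟩
  toℕ (p zero) + count (p ∘ suc)   ≡⟨ cong₂ _+_ (cong toℕ (¬-not (empty zero))) (count-empty (empty ∘ suc)) ⟩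
  0                                ∎
  where open ≡-Reasoning

count-∨+count-∧ : count (λ x → p x ∨ q x) + count (λ x → p x ∧ q x) ≡ count p + count q
count-∨+count-∧ {n} {p} {q} = begin
  count (λ x → p x ∨ q x) + count (λ x → p x ∧ q x)
    ≡⟨ cong₂ _+_ (count-∑ (λ x → p x ∨ q x)) (count-∑ (λ x → p x ∧ q x)) ⟩
  ∑[ x < n ] toℕ (p x ∨ q x) + ∑[ x < n ] toℕ (p x ∧ q x)
    ≡⟨ ∑-distrib-+ (λ x → toℕ (p x ∨ q x)) (λ x → toℕ (p x ∧ q x)) ⟨
  ∑[ x < n ] (toℕ (p x ∨ q x) + toℕ (p x ∧ q x))
    ≡⟨ sum-cong-≗ (λ x → pointwise (p x) (q x)) ⟩
  ∑[ x < n ] (toℕ (p x) + toℕ (q x))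
    ≡⟨ ∑-distrib-+ (toℕ ∘ p) (toℕ ∘ q) ⟩
  ∑[ x < n ] toℕ (p x) + ∑[ x < n ] toℕ (q x)
    ≡⟨ cong₂ _+_ (count-∑ p) (count-∑ q) ⟨
  count p + count q ∎
  where
  open ≡-Reasoning
  pointwise : ∀ a b → toℕ (a ∨ b) + toℕ (a ∧ b) ≡ toℕ a + toℕ b
  pointwise false false = refl
  pointwise false true  = refl
  pointwise true  false = refl
  pointwise true  true  = refl

count-∨≤ : count (λ x → p x ∨ q x) ≤ count p + count q
count-∨≤ {p = p} {q} = subst (count (λ x → p x ∨ q x) ≤_) (count-∨+count-∧ {p = p} {q}) (m≤m+n _ _)

count-not+count : (p : Fin n → Bool) → count (not ∘ p) + count p ≡ n
count-not+count {n} p = begin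
  count (not ∘ p) + count p                                       ≡⟨ count-∨+count-∧ {p = not ∘ p} ⟨
  count (λ x → not (p x) ∨ p x) + count (λ x → not (p x) ∧ p x)  ≡⟨ cong₂ _+_ excluded-middle non-contradiction ⟩
  n + 0                                                           ≡⟨ +-identityʳ n ⟩
  n                                                               ∎
  where
  open ≡-Reasoning
  excluded-middle : count (λ x → not (p x) ∨ p x) ≡ n
  excluded-middle = trans (count-cong (λ x → ∨-inverseˡ (p x))) count-true
  non-contradiction : count (λ x → not (p x) ∧ p x) ≡ 0
  non-contradiction = trans (count-cong (λ x → ∧-inverseˡ (p x))) (count-empty {n} {λ _ → false} λ _ ())

count-remove : {a : Fin n} → p a ≡ true → count p ≡ suc (count (p - a))
count-remove {suc n} {p} {zero} pa = begin
  count p                                               ≡⟨ count-suc p ⟩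
  toℕ (p zero) + count (p ∘ suc)                        ≡⟨ cong₂ (λ b c → toℕ b + c) pa drop-true ⟩
  suc (count ((p - zero) ∘ suc))
    ≡⟨ cong (λ b → suc (toℕ b + count ((p - zero) ∘ suc))) (∧-zeroʳ (p zero)) ⟨
  suc (toℕ (p zero ∧ false) + count ((p - zero) ∘ suc)) ≡⟨ cong suc (count-suc (p - zero)) ⟨
  suc (count (p - zero))                                ∎
  where
  open ≡-Reasoning
  drop-true : count (p ∘ suc) ≡ count ((p - zero) ∘ suc)
  drop-true = count-cong (λ x → sym (∧-identityʳ (p (suc x))))
count-remove {suc n} {p} {suc a} pa = begin
  count p                                                ≡⟨ count-suc p ⟩
  toℕ (p zero) + count (p ∘ suc)                         ≡⟨ cong (toℕ (p zero) +_) (count-remove {p = p ∘ suc} pa) ⟩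
  toℕ (p zero) + suc (count ((p ∘ suc) - a))             ≡⟨ +-suc _ _ ⟩
  suc (toℕ (p zero) + count ((p ∘ suc) - a))
    ≡⟨ cong suc (cong₂ _+_ (cong toℕ (∧-identityʳ (p zero))) shift) ⟨
  suc (toℕ (p zero ∧ true) + count ((p - suc a) ∘ suc))  ≡⟨ cong suc (count-suc (p - suc a)) ⟨
  suc (count (p - suc a))                                ∎
  where
  open ≡-Reasoning
  shift : count ((p - suc a) ∘ suc) ≡ count ((p ∘ suc) - a)
  shift = count-cong (λ x → cong (λ b → p (suc x) ∧ not b) (⌊suc≟suc⌋ x a))

1≤count : {a : Fin n} → p a ≡ true → 1 ≤ count p
1≤count {p = p} pa = subst (1 ≤_) (sym (count-remove {p = p} pa)) (s≤s z≤n)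

count-witness : 1 ≤ count p → ∃ λ x → p x ≡ true
count-witness {suc n} {p} 1≤c = search (p zero) refl
  where
  search : (b : Bool) → p zero ≡ b → ∃ λ x → p x ≡ true
  search true  p0 = zero , p0
  search false p0 =
    let 1≤c′ = subst (1 ≤_) (trans (count-suc p) (cong (λ b → toℕ b + count (p ∘ suc)) p0)) 1≤c
        x , px = count-witness {p = p ∘ suc} 1≤c′
    in suc x , px

count≤1 : (∀ x y → p x ≡ true → p y ≡ true → x ≡ y) → count p ≤ 1
count≤1 {p = p} unique with count p in c
... | zero  = z≤n
... | suc k with count-witness {p = p} (subst (1 ≤_) (sym c) (s≤s z≤n))
...   | a , pa = ≤-reflexive (begin
  suc k                   ≡⟨ c ⟨
  count p                 ≡⟨ count-remove {p = p} pa ⟩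
  suc (count (p - a))     ≡⟨ cong suc (count-empty others-empty) ⟩
  1                       ∎)
  where
  open ≡-Reasoning
  others-empty : ∀ x → ¬ (p - a) x ≡ true
  others-empty x px∧x≢a = let px , x≢a = remove-elim {p = p} px∧x≢a in x≢a (unique x a px pa)

count≤toℕ : (p : Fin n → Bool) (b : Bool) → (∀ x → p x ≡ true → b ≡ true) →
            (∀ x y → p x ≡ true → p y ≡ true → x ≡ y) → count p ≤ toℕ b
count≤toℕ p true  _   unique = count≤1 unique
count≤toℕ p false p⇒b _      = ≤-reflexive (count-empty λ x px → contradiction (p⇒b x px) λ ())

count≡1⇒unique : count p ≡ 1 → ∀ {x y} → p x ≡ true → p y ≡ true → x ≡ y
count≡1⇒unique {p = p} c≡1 {x} {y} px py with y ≟ x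
... | yes y≡x = sym y≡x
... | no  y≢x = contradiction (begin
  1                   ≤⟨ 1≤count {p = p - x} (remove-intro {p = p} py y≢x) ⟩
  count (p - x)       ≡⟨ suc-injective (trans (sym (count-remove {p = p} px)) c≡1) ⟩
  0                   ∎) λ ()
  where open ≤-Reasoning

count≢1⇒other : count p ≢ 1 → ∀ {a} → p a ≡ true → ∃ λ x → x ≢ a × p x ≡ true
count≢1⇒other {p = p} c≢1 {a} pa =
  let x , px∧x≢a = count-witness {p = p - a} (n≢0⇒n>0 others≢0)
      px , x≢a = remove-elim {p = p} px∧x≢a
  in x , x≢a , px
  where
  others≢0 : count (p - a) ≢ 0
  others≢0 c≡0 = c≢1 (trans (count-remove {p = p} pa) (cong suc c≡0))

∑-count-comm : (T : Fin m → Fin n → Bool) → ∑[ x < m ] count (T x) ≡ ∑[ y < n ] count (λ x → T x y)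
∑-count-comm {m} {n} T = begin
  ∑[ x < m ] count (T x)                ≡⟨ sum-cong-≗ (λ x → count-∑ (T x)) ⟩
  ∑[ x < m ] ∑[ y < n ] toℕ (T x y)     ≡⟨ ∑-comm (λ x y → toℕ (T x y)) ⟩
  ∑[ y < n ] ∑[ x < m ] toℕ (T x y)     ≡⟨ sum-cong-≗ (λ y → count-∑ (λ x → T x y)) ⟨
  ∑[ y < n ] count (λ x → T x y)        ∎
  where open ≡-Reasoning

count≤∑-count : (T : Fin m → Fin n → Bool) → (∀ y → p y ≡ true → ∃ λ x → T x y ≡ true) →
                count p ≤ ∑[ x < m ] count (T x)
count≤∑-count {m} {n} {p} T covered = begin
  count p                          ≡⟨ count-∑ p ⟩
  ∑[ y < n ] toℕ (p y)             ≤⟨ ∑-mono-≤ bound ⟩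
  ∑[ y < n ] count (λ x → T x y)   ≡⟨ ∑-count-comm T ⟨
  ∑[ x < m ] count (T x)           ∎
  where
  open ≤-Reasoning
  bound : ∀ y → toℕ (p y) ≤ count (λ x → T x y)
  bound y with p y in py
  ... | false = z≤n
  ... | true  = 1≤count {p = λ x → T x y} (proj₂ (covered y py))

module _ {n : ℕ} (G : Graph n) where

  adj-sym : ∀ {u v} → adj G u v ≡ true → adj G v u ≡ true
  adj-sym {u} {v} uv = trans (Graph.sym G v u) uv

  closedNbr-refl : ∀ v → closedNbr G v v ≡ true
  closedNbr-refl v rewrite ⌊≟⌋-refl v = refl

  closedNbr-adj : ∀ {v w} → adj G v w ≡ true → closedNbr G v w ≡ true
  closedNbr-adj {v} {w} vw rewrite vw = ∨-zeroʳ ⌊ v ≟ w ⌋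

  closedNbr-≢ : ∀ {v w} → v ≢ w → closedNbr G v w ≡ adj G v w
  closedNbr-≢ v≢w rewrite ⌊≟⌋-≢ v≢w = refl

  closedNbr⇒ : ∀ {v w} → closedNbr G v w ≡ true → v ≡ w ⊎ adj G v w ≡ true
  closedNbr⇒ {v} {w} vw with v ≟ w
  ... | yes v≡w = inj₁ v≡w
  ... | no  _   = inj₂ vw

  TriangleFree : Set
  TriangleFree = ∀ {u v w} → adj G u v ≡ true → adj G v w ≡ true → adj G u w ≡ true → ⊥

  ProperColouring : (Fin n → Bool) → Set
  ProperColouring c = ∀ u v → adj G u v ≡ true → c u ≢ c v

  proper-not : {c : Fin n → Bool} → ProperColouring c → ProperColouring (not ∘ c)
  proper-not proper u v uv = proper u v uv ∘ not-injective

  proper-common-neighbour : {c : Fin n → Bool} → ProperColouring c →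
                            ∀ {u v w} → adj G v u ≡ true → adj G v w ≡ true → c u ≡ c w
  proper-common-neighbour proper vu vw = ≢-≢⇒≡ (≢-sym (proper _ _ vu)) (proper _ _ vw)

  bipartite⇒triangle-free : Bipartite G → TriangleFree
  bipartite⇒triangle-free (c , proper) uv vw uw =
    proper _ _ uw (proper-common-neighbour proper (adj-sym uv) vw)

  isLeaf⇒degree≡1 : ∀ {u} → isLeaf G u ≡ true → degree G u ≡ 1
  isLeaf⇒degree≡1 {u} _ with degree G u ℕ.≟ 1
  ... | yes d≡1 = d≡1

  degree≡1⇒isLeaf : ∀ {u} → degree G u ≡ 1 → isLeaf G u ≡ true
  degree≡1⇒isLeaf {u} d≡1 with degree G u ℕ.≟ 1
  ... | yes _   = refl
  ... | no  d≢1 = contradiction d≡1 d≢1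

  leaf-neighbour-unique : ∀ {u x y} → isLeaf G u ≡ true → adj G u x ≡ true → adj G u y ≡ true → x ≡ y
  leaf-neighbour-unique leaf = count≡1⇒unique (isLeaf⇒degree≡1 leaf)

  non-leaf-other-neighbour : ∀ {u y} → isLeaf G u ≡ false → adj G u y ≡ true → ∃ λ w → w ≢ y × adj G u w ≡ true
  non-leaf-other-neighbour non-leaf =
    count≢1⇒other (λ d≡1 → contradiction (trans (sym non-leaf) (degree≡1⇒isLeaf d≡1)) λ ())

  Independent : (Fin n → Bool) → Set
  Independent S = ∀ {u v} → adj G u v ≡ true → S u ≡ true → S v ≡ true → ⊥

  OpenTwins : Fin n → Fin n → Set
  OpenTwins u v = ∀ w → adj G u w ≡ adj G v w

  OpenTwinFree : (Fin n → Bool) → Set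
  OpenTwinFree S = ∀ {u v} → u ≢ v → S u ≡ true → S v ≡ true → ¬ OpenTwins u v

  OtherNeighbourOutside : (Fin n → Bool) → Fin n → Fin n → Set
  OtherNeighbourOutside S u v = ∃ λ w → w ≢ v × adj G u w ≡ true × S w ≡ false

  other-neighbour-outside? : (S : Fin n → Bool) → ∀ u v → Dec (OtherNeighbourOutside S u v)
  other-neighbour-outside? S u v = any? λ w → ¬? (w ≟ v) ×-dec adj G u w Bool.≟ true ×-dec S w Bool.≟ false

  EdgesGuarded : (Fin n → Bool) → Set
  EdgesGuarded S = ∀ {u v} → adj G u v ≡ true → OtherNeighbourOutside S u v ⊎ OtherNeighbourOutside S v u

  SameTrace : (Fin n → Bool) → Fin n → Fin n → Set
  SameTrace C u v = ∀ w → closedNbr G u w ∧ C w ≡ closedNbr G v w ∧ C w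

  module _ (triangle-free : TriangleFree) (has-neighbour : ∀ v → ∃ λ w → adj G v w ≡ true)
           {S : Fin n → Bool} (independent : Independent S) (twin-free : OpenTwinFree S)
           (guarded : EdgesGuarded S) where

    private
      in-trace : ∀ {v w} → closedNbr G v w ≡ true → S w ≡ false → closedNbr G v w ∧ not (S w) ≡ true
      in-trace vw Sw rewrite vw | Sw = refl

      shared : ∀ {u v w} → SameTrace (not ∘ S) u v → closedNbr G u w ≡ true → S w ≡ false → closedNbr G v w ≡ true
      shared {v = v} {w} same uw Sw = ∧-conicalˡ (closedNbr G v w) _ (trans (sym (same w)) (in-trace uw Sw))

      guard-separates : ∀ {u v} → adj G u v ≡ true → OtherNeighbourOutside S u v → ¬ SameTrace (not ∘ S) u v
      guard-separates uv (w , w≢v , uw , Sw) same with closedNbr⇒ (shared same (closedNbr-adj uw) Sw)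
      ... | inj₁ v≡w = w≢v (sym v≡w)
      ... | inj₂ vw  = triangle-free uv vw uw

      adjacent-separated : ∀ {u v} → adj G u v ≡ true → ¬ SameTrace (not ∘ S) u v
      adjacent-separated uv same with guarded uv
      ... | inj₁ u-guard = guard-separates uv u-guard same
      ... | inj₂ v-guard = guard-separates (adj-sym uv) v-guard (sym ∘ same)

      same-trace⇒open-twins : ∀ {u v} → S u ≡ true → S v ≡ true → SameTrace (not ∘ S) u v → OpenTwins u v
      same-trace⇒open-twins {u} {v} Su Sv same w with S w in Sw
      ... | true  = trans (non-adjacent Su) (sym (non-adjacent Sv))
        where
        non-adjacent : ∀ {x} → S x ≡ true → adj G x w ≡ false
        non-adjacent Sx = ¬-not λ xw → independent xw Sx Sw
      ... | false = begin
        adj G u w                     ≡⟨ closedNbr-≢ (≢-outside Su) ⟨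
        closedNbr G u w               ≡⟨ ∧-identityʳ _ ⟨
        closedNbr G u w ∧ true        ≡⟨ cong (λ b → closedNbr G u w ∧ not b) Sw ⟨
        closedNbr G u w ∧ not (S w)   ≡⟨ same w ⟩
        closedNbr G v w ∧ not (S w)   ≡⟨ cong (λ b → closedNbr G v w ∧ not b) Sw ⟩
        closedNbr G v w ∧ true        ≡⟨ ∧-identityʳ _ ⟩
        closedNbr G v w               ≡⟨ closedNbr-≢ (≢-outside Sv) ⟩
        adj G v w                     ∎
        where
        open ≡-Reasoning
        ≢-outside : ∀ {x} → S x ≡ true → x ≢ w
        ≢-outside Sx refl = contradiction (trans (sym Sx) Sw) λ ()

      dominating : ∀ v → ∃ λ w → closedNbr G v w ∧ not (S w) ≡ true
      dominating v with S v in Sv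
      ... | false = v , in-trace (closedNbr-refl v) Sv
      ... | true  = let w , vw = has-neighbour v in w , in-trace (closedNbr-adj vw) (¬-not (independent vw Sv))

      separating : ∀ u v → u ≢ v → ¬ SameTrace (not ∘ S) u v
      separating u v u≢v same with S u in Su | S v in Sv
      ... | false | _ with closedNbr⇒ (shared same (closedNbr-refl u) Su)
      ...   | inj₁ v≡u = u≢v (sym v≡u)
      ...   | inj₂ vu  = adjacent-separated (adj-sym vu) same
      separating u v u≢v same | true | false with closedNbr⇒ (shared (sym ∘ same) (closedNbr-refl v) Sv)
      ...   | inj₁ u≡v = u≢v u≡v
      ...   | inj₂ uv  = adjacent-separated uv same
      separating u v u≢v same | true | true = twin-free u≢v Su Sv (same-trace⇒open-twins Su Sv same)

    complement-identifying : IdentifyingCode G (not ∘ S)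
    complement-identifying = dominating , separating

  leafNeighbour : Fin n → Fin n → Bool
  leafNeighbour u w = adj G u w ∧ isLeaf G w

  support-intro : ∀ {u w} → adj G u w ≡ true → isLeaf G w ≡ true → isSupport G u ≡ true
  support-intro {u} uw w-leaf = any-allFin⁺ (leafNeighbour u) (∧-intro uw w-leaf)

  leafOf : Fin n → Fin n
  leafOf u = choose (leafNeighbour u) u

  leafOf-spec : ∀ u → (adj G u (leafOf u) ≡ true × isLeaf G (leafOf u) ≡ true) ⊎ leafOf u ≡ u
  leafOf-spec u with choose-spec (leafNeighbour u) u
  ... | inj₁ found         = inj₁ (∧-conicalˡ _ _ found , ∧-conicalʳ _ _ found)
  ... | inj₂ (default , _) = inj₂ default

  leafOf-support : ∀ {u} → isSupport G u ≡ true → adj G u (leafOf u) ≡ true × isLeaf G (leafOf u) ≡ true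
  leafOf-support {u} support with choose-spec (leafNeighbour u) u
  ... | inj₁ found     = ∧-conicalˡ _ _ found , ∧-conicalʳ _ _ found
  ... | inj₂ (_ , none) = contradiction (proj₂ (any-allFin⁻ (leafNeighbour u) support)) (none _)

  leafOf-neighbour : ∀ {x z} → adj G (leafOf x) z ≡ true → z ≡ x ⊎ adj G x z ≡ true
  leafOf-neighbour {x} leaf-z with leafOf-spec x
  ... | inj₁ (x~leaf , leaf) = inj₁ (leaf-neighbour-unique leaf leaf-z (adj-sym x~leaf))
  ... | inj₂ leafOf-x≡x      = inj₂ (subst (λ y → adj G y _ ≡ true) leafOf-x≡x leaf-z)

  leafOf-neighbour-unique : ∀ {u v} → isSupport G u ≡ true → adj G v (leafOf u) ≡ true → v ≡ u
  leafOf-neighbour-unique support v~leaf =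
    let u~leaf , leaf = leafOf-support support
    in leaf-neighbour-unique leaf (adj-sym v~leaf) (adj-sym u~leaf)

  chosenBy : Fin n → Fin n → Bool
  chosenBy v w = isSupport G v ∧ ⌊ w ≟ leafOf v ⌋

  chosenLeaves : Fin n → Bool
  chosenLeaves w = any (λ v → chosenBy v w) (allFin n)

  chosenBy-elim : ∀ {v w} → chosenBy v w ≡ true → isSupport G v ≡ true × w ≡ leafOf v
  chosenBy-elim chosen = ∧-conicalˡ _ _ chosen , ⌊≟⌋⇒≡ (∧-conicalʳ _ _ chosen)

  chosenLeaves-elim : ∀ {w} → chosenLeaves w ≡ true → ∃ λ v → isSupport G v ≡ true × w ≡ leafOf v
  chosenLeaves-elim {w} chosen = let v , chosen-by-v = any-allFin⁻ (λ v → chosenBy v w) chosen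
                                 in v , chosenBy-elim chosen-by-v

  chosenLeaves-leaf : ∀ {w} → chosenLeaves w ≡ true → isLeaf G w ≡ true
  chosenLeaves-leaf chosen with chosenLeaves-elim chosen
  ... | v , support , refl = proj₂ (leafOf-support support)

  chosenLeaves-neighbour : ∀ {u w} → chosenLeaves w ≡ true → adj G u w ≡ true → w ≡ leafOf u
  chosenLeaves-neighbour chosen uw with chosenLeaves-elim chosen
  ... | v , support , refl = cong leafOf (sym (leafOf-neighbour-unique support uw))

  chosenLeaves-twin-free : OpenTwinFree chosenLeaves
  chosenLeaves-twin-free {u} {v} u≢v u-chosen v-chosen twins with chosenLeaves-elim u-chosen
  ... | x , support , refl =
    let xu = proj₁ (leafOf-support support)
    in u≢v (sym (chosenLeaves-neighbour v-chosen (adj-sym (trans (sym (twins x)) (adj-sym xu)))))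

  unguarded-neighbour : ∀ {x y z} → ¬ OtherNeighbourOutside chosenLeaves x y → adj G x z ≡ true →
                        z ≡ y ⊎ z ≡ leafOf x
  unguarded-neighbour {y = y} {z} unguarded xz with z ≟ y
  ... | yes z≡y = inj₁ z≡y
  ... | no  z≢y = inj₂ (chosenLeaves-neighbour (¬-not λ unchosen → unguarded (z , z≢y , xz , unchosen)) xz)

  numSupport≤count-chosenLeaves : numSupport G ≤ count chosenLeaves
  numSupport≤count-chosenLeaves = begin
    numSupport G                           ≤⟨ count≤∑-count (λ w v → chosenBy v w) (λ v s → leafOf v , chooses s) ⟩
    ∑[ w < n ] count (λ v → chosenBy v w)  ≤⟨ ∑-mono-≤ column ⟩
    ∑[ w < n ] toℕ (chosenLeaves w)        ≡⟨ count-∑ chosenLeaves ⟨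
    count chosenLeaves                     ∎
    where
    open ≤-Reasoning
    chooses : ∀ {v} → isSupport G v ≡ true → chosenBy v (leafOf v) ≡ true
    chooses support = ∧-intro support (⌊≟⌋-refl _)
    chosen-once : ∀ {w} v v′ → chosenBy v w ≡ true → chosenBy v′ w ≡ true → v ≡ v′
    chosen-once v v′ v-chooses v′-chooses with chosenBy-elim v-chooses | chosenBy-elim v′-chooses
    ... | v-support , refl | v′-support , leafOf-v≡leafOf-v′ =
      leafOf-neighbour-unique v′-support
        (subst (λ x → adj G v x ≡ true) leafOf-v≡leafOf-v′ (proj₁ (leafOf-support v-support)))
    column : ∀ w → count (λ v → chosenBy v w) ≤ toℕ (chosenLeaves w)
    column w = count≤toℕ (λ v → chosenBy v w) (chosenLeaves w) (λ v → any-allFin⁺ (λ v → chosenBy v w)) chosen-once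

  leaves-code-size : count (not ∘ chosenLeaves) + numSupport G ≤ n
  leaves-code-size = begin
    count (not ∘ chosenLeaves) + numSupport G          ≤⟨ +-monoʳ-≤ _ numSupport≤count-chosenLeaves ⟩
    count (not ∘ chosenLeaves) + count chosenLeaves    ≡⟨ count-not+count chosenLeaves ⟩
    n                                                  ∎
    where open ≤-Reasoning

  -- When every neighbour of u is a leaf, nonLeafOf u = leafOf u, so that all leaves of u get claimed.
  nonLeafOf : Fin n → Fin n
  nonLeafOf u = choose (λ w → adj G u w ∧ not (isLeaf G w)) (leafOf u)

  claimedBy : Fin n → Fin n → Bool
  claimedBy v w = isSupport G v ∧ ((leafNeighbour v - leafOf v) w ∨ ⌊ w ≟ nonLeafOf v ⌋)

  claimed : Fin n → Bool
  claimed w = any (λ v → claimedBy v w) (allFin n)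

  claimed-intro : ∀ {v w} → isSupport G v ≡ true →
                  (leafNeighbour v w ≡ true × w ≢ leafOf v) ⊎ w ≡ nonLeafOf v → claimed w ≡ true
  claimed-intro {v} {w} support reason = any-allFin⁺ (λ v → claimedBy v w) (∧-intro support (claims reason))
    where
    claims : (leafNeighbour v w ≡ true × w ≢ leafOf v) ⊎ w ≡ nonLeafOf v →
             (leafNeighbour v - leafOf v) w ∨ ⌊ w ≟ nonLeafOf v ⌋ ≡ true
    claims (inj₁ (leaf-w , w≢leafOf-v)) rewrite remove-intro {p = leafNeighbour v} leaf-w w≢leafOf-v = refl
    claims (inj₂ refl) rewrite ⌊≟⌋-refl (nonLeafOf v) = ∨-zeroʳ _

  unclaimed-leaf : ∀ {x u} → adj G x u ≡ true → isLeaf G u ≡ true → claimed u ≡ false → u ≡ leafOf x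
  unclaimed-leaf {x} {u} xu u-leaf unclaimed with u ≟ leafOf x
  ... | yes u≡leafOf-x = u≡leafOf-x
  ... | no  u≢leafOf-x =
    let claimed-u = claimed-intro (support-intro xu u-leaf) (inj₁ (∧-intro xu u-leaf , u≢leafOf-x))
    in contradiction (trans (sym claimed-u) unclaimed) λ ()

  count-claimedBy : ∀ v → count (claimedBy v) ≤ count (leafNeighbour v)
  count-claimedBy v with isSupport G v Bool.≟ true
  ... | no unsupported =
    subst (_≤ count (leafNeighbour v)) (sym (count-empty {p = claimedBy v} λ w → unsupported ∘ ∧-conicalˡ _ _)) z≤n
  ... | yes support = begin
    count (claimedBy v)                                ≡⟨ count-cong {q = λ w → others w ∨ other w} supported ⟩
    count (λ w → others w ∨ other w)                   ≤⟨ count-∨≤ {p = others} ⟩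
    count others + count other                         ≤⟨ +-monoʳ-≤ (count others) (count≤1 single) ⟩
    count others + 1                                   ≡⟨ +-comm (count others) 1 ⟩
    suc (count others)                                 ≡⟨ count-remove {p = leafNeighbour v} chosen ⟨
    count (leafNeighbour v)                            ∎
    where
    open ≤-Reasoning
    others other : Fin n → Bool
    others = leafNeighbour v - leafOf v
    other w = ⌊ w ≟ nonLeafOf v ⌋
    supported : ∀ w → claimedBy v w ≡ others w ∨ other w
    supported w = cong (_∧ (others w ∨ other w)) support
    chosen : leafNeighbour v (leafOf v) ≡ true
    chosen = uncurry ∧-intro (leafOf-support support)
    single : ∀ x y → ⌊ x ≟ nonLeafOf v ⌋ ≡ true → ⌊ y ≟ nonLeafOf v ⌋ ≡ true → x ≡ y
    single x y x≡ y≡ = trans (⌊≟⌋⇒≡ x≡) (sym (⌊≟⌋⇒≡ y≡))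

  count-claimed≤numLeaves : count claimed ≤ numLeaves G
  count-claimed≤numLeaves = begin
    count claimed                               ≤⟨ count≤∑-count claimedBy (λ w → any-allFin⁻ (λ v → claimedBy v w)) ⟩
    ∑[ v < n ] count (claimedBy v)              ≤⟨ ∑-mono-≤ count-claimedBy ⟩
    ∑[ v < n ] count (leafNeighbour v)          ≡⟨ ∑-count-comm leafNeighbour ⟩
    ∑[ w < n ] count (λ v → leafNeighbour v w)  ≤⟨ ∑-mono-≤ column ⟩
    ∑[ w < n ] toℕ (isLeaf G w)                 ≡⟨ count-∑ (isLeaf G) ⟨
    numLeaves G                                 ∎
    where
    open ≤-Reasoning
    unique-support : ∀ {w} v v′ → leafNeighbour v w ≡ true → leafNeighbour v′ w ≡ true → v ≡ v′
    unique-support v v′ vw v′w =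
      leaf-neighbour-unique (∧-conicalʳ _ _ vw) (adj-sym (∧-conicalˡ _ _ vw)) (adj-sym (∧-conicalˡ _ _ v′w))
    column : ∀ w → count (λ v → leafNeighbour v w) ≤ toℕ (isLeaf G w)
    column w = count≤toℕ (λ v → leafNeighbour v w) (isLeaf G w) (λ v → ∧-conicalʳ _ _) unique-support

  unclaimedClass : (Fin n → Bool) → Fin n → Bool
  unclaimedClass c w = c w ∧ not (claimed w)

  class-codes-size : (c : Fin n → Bool) →
                     count (not ∘ unclaimedClass c) + count (not ∘ unclaimedClass (not ∘ c)) ≤ n + numLeaves G
  class-codes-size c = begin
    count (not ∘ unclaimedClass c) + count (not ∘ unclaimedClass (not ∘ c))
      ≡⟨ count-∨+count-∧ {p = not ∘ unclaimedClass c} ⟨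
    count (λ w → not (unclaimedClass c w) ∨ not (unclaimedClass (not ∘ c) w)) +
    count (λ w → not (unclaimedClass c w) ∧ not (unclaimedClass (not ∘ c) w))
      ≡⟨ cong₂ _+_ (trans (count-cong (λ w → covered (c w) (claimed w))) count-true)
                   (count-cong (λ w → classes-overlap (c w) (claimed w))) ⟩
    n + count claimed
      ≤⟨ +-monoʳ-≤ n count-claimed≤numLeaves ⟩
    n + numLeaves G ∎
    where
    open ≤-Reasoning
    covered : ∀ a r → not (a ∧ not r) ∨ not (not a ∧ not r) ≡ true
    covered false r     = refl
    covered true  false = refl
    covered true  true  = refl
    classes-overlap : ∀ a r → not (a ∧ not r) ∧ not (not a ∧ not r) ≡ r
    classes-overlap false false = refl
    classes-overlap false true  = refl
    classes-overlap true  false = refl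
    classes-overlap true  true  = refl

  module _ (connected : Connected G) where

    closed-list-length : ∀ {x xs} → x ∈ xs → (∀ {y z} → y ∈ xs → adj G y z ≡ true → z ∈ xs) → n ≤ length xs
    closed-list-length {x} {xs} x∈xs closed = ≮⇒≥ λ length<n →
      let i , j , i<j , index-i≡index-j = pigeonhole length<n (Any.index ∘ covers)
      in Fin.<⇒≢ i<j (begin
           i                                   ≡⟨ lookup-index (covers i) ⟩
           lookup xs (Any.index (covers i))    ≡⟨ cong (lookup xs) index-i≡index-j ⟩
           lookup xs (Any.index (covers j))    ≡⟨ lookup-index (covers j) ⟨
           j                                   ∎)
      where
      open ≡-Reasoning
      reach : ∀ {u v} → Reachable G u v → u ∈ xs → v ∈ xs
      reach here          u∈xs = u∈xs
      reach (step uw w⇝v) u∈xs = reach w⇝v (closed u∈xs uw)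
      covers : ∀ y → y ∈ xs
      covers y = reach (connected x y) x∈xs

    has-neighbour : 2 ≤ n → ∀ u → ∃ λ w → adj G u w ≡ true
    has-neighbour 2≤n u with 1 ≤? degree G u
    ... | yes 1≤d = count-witness 1≤d
    ... | no  1≰d = contradiction (closed-list-length (here refl) isolated) (<⇒≱ 2≤n)
      where
      isolated : ∀ {y z} → y ∈ [ u ] → adj G y z ≡ true → z ∈ [ u ]
      isolated (here refl) uz = contradiction (1≤count {p = adj G u} uz) 1≰d

    leaves-nonadjacent : 3 ≤ n → ∀ {u v} → isLeaf G u ≡ true → isLeaf G v ≡ true → adj G u v ≡ true → ⊥
    leaves-nonadjacent 3≤n {u} {v} u-leaf v-leaf uv =
      contradiction (closed-list-length (here refl) closed) (<⇒≱ 3≤n)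
      where
      closed : ∀ {y z} → y ∈ u ∷ v ∷ [] → adj G y z ≡ true → z ∈ u ∷ v ∷ []
      closed (here refl)         uz = there (here (leaf-neighbour-unique u-leaf uz uv))
      closed (there (here refl)) vz = here (leaf-neighbour-unique v-leaf vz (adj-sym uv))

    chosenLeaves-independent : 3 ≤ n → Independent chosenLeaves
    chosenLeaves-independent 3≤n uv u-chosen v-chosen =
      leaves-nonadjacent 3≤n (chosenLeaves-leaf u-chosen) (chosenLeaves-leaf v-chosen) uv

    -- Otherwise u, v, leafOf u and leafOf v would make up a whole component.
    chosenLeaves-guarded : 5 ≤ n → EdgesGuarded chosenLeaves
    chosenLeaves-guarded 5≤n {u} {v} uv
      with other-neighbour-outside? chosenLeaves u v | other-neighbour-outside? chosenLeaves v u
    ... | yes u-guard | _           = inj₁ u-guard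
    ... | no _        | yes v-guard = inj₂ v-guard
    ... | no u-open   | no v-open   = contradiction (closed-list-length (here refl) closed) (<⇒≱ 5≤n)
      where
      component : List (Fin n)
      component = u ∷ v ∷ leafOf u ∷ leafOf v ∷ []
      from-u : ∀ {z} → adj G u z ≡ true → z ∈ component
      from-u uz with unguarded-neighbour u-open uz
      ... | inj₁ refl = there (here refl)
      ... | inj₂ refl = there (there (here refl))
      from-v : ∀ {z} → adj G v z ≡ true → z ∈ component
      from-v vz with unguarded-neighbour v-open vz
      ... | inj₁ refl = here refl
      ... | inj₂ refl = there (there (there (here refl)))
      closed : ∀ {y z} → y ∈ component → adj G y z ≡ true → z ∈ component
      closed (here refl)                         = from-u
      closed (there (here refl))                 = from-v
      closed (there (there (here refl))) leaf-z with leafOf-neighbour leaf-z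
      ... | inj₁ refl = here refl
      ... | inj₂ uz   = from-u uz
      closed (there (there (there (here refl)))) leaf-z with leafOf-neighbour leaf-z
      ... | inj₁ refl = there (here refl)
      ... | inj₂ vz   = from-v vz

    support-claims : 3 ≤ n → ∀ {u v} → adj G u v ≡ true → isLeaf G v ≡ true →
                     ∃ λ w → w ≢ v × adj G u w ≡ true × claimed w ≡ true
    support-claims 3≤n {u} {v} uv v-leaf with choose-spec (λ w → adj G u w ∧ not (isLeaf G w)) (leafOf u)
    ... | inj₁ found =
      nonLeafOf u , non-leaf≢v , ∧-conicalˡ _ _ found , claimed-intro (support-intro uv v-leaf) (inj₂ refl)
      where
      non-leaf≢v : nonLeafOf u ≢ v
      non-leaf≢v refl = contradiction (trans (sym (∧-conicalʳ _ _ found)) (cong not v-leaf)) λ ()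
    ... | inj₂ (nonLeafOf-u≡leafOf-u , no-non-leaf) =
      let w , w≢v , uw = non-leaf-other-neighbour u-non-leaf uv in w , w≢v , uw , claimed-other uw
      where
      u-non-leaf : isLeaf G u ≡ false
      u-non-leaf = ¬-not λ u-leaf → leaves-nonadjacent 3≤n u-leaf v-leaf uv
      claimed-other : ∀ {w} → adj G u w ≡ true → claimed w ≡ true
      claimed-other {w} uw with w ≟ leafOf u
      ... | yes w≡leafOf-u =
        claimed-intro (support-intro uv v-leaf) (inj₂ (trans w≡leafOf-u (sym nonLeafOf-u≡leafOf-u)))
      ... | no  w≢leafOf-u =
        claimed-intro (support-intro uv v-leaf) (inj₁ (∧-intro uw w-leaf , w≢leafOf-u))
        where
        w-leaf : isLeaf G w ≡ true
        w-leaf = ¬-not λ w-non-leaf → no-non-leaf w (∧-intro uw (cong not w-non-leaf))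

    module _ {c : Fin n → Bool} (proper : ProperColouring c) where

      unclaimedClass-independent : Independent (unclaimedClass c)
      unclaimedClass-independent uv u-in v-in =
        proper _ _ uv (trans (∧-conicalˡ _ _ u-in) (sym (∧-conicalˡ _ _ v-in)))

      unclaimedClass-twin-free : 2 ≤ n → NoTwinsDeg2 G → OpenTwinFree (unclaimedClass c)
      unclaimedClass-twin-free 2≤n no-twins {u} {v} u≢v u-in v-in twins with 2 ≤? degree G u
      ... | yes 2≤du = proj₁ (no-twins u v u≢v 2≤du (subst (2 ≤_) (count-cong twins) 2≤du)) twins
      ... | no  2≰du = u≢v (trans (is-leafOf u-in ux du≡1) (sym (is-leafOf v-in vx dv≡1)))
        where
        x : Fin n
        x = proj₁ (has-neighbour 2≤n u)
        ux : adj G u x ≡ true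
        ux = proj₂ (has-neighbour 2≤n u)
        vx : adj G v x ≡ true
        vx = trans (sym (twins x)) ux
        du≡1 : degree G u ≡ 1
        du≡1 = sym (≤∧≮⇒≡ (1≤count {p = adj G u} ux) 2≰du)
        dv≡1 : degree G v ≡ 1
        dv≡1 = trans (sym (count-cong twins)) du≡1
        is-leafOf : ∀ {y} → unclaimedClass c y ≡ true → adj G y x ≡ true → degree G y ≡ 1 → y ≡ leafOf x
        is-leafOf y-in yx dy≡1 =
          unclaimed-leaf (adj-sym yx) (degree≡1⇒isLeaf dy≡1) (not-injective (∧-conicalʳ _ _ y-in))

      edge-into-class-guarded : 3 ≤ n → ∀ {u v} → c v ≡ true → adj G u v ≡ true →
        OtherNeighbourOutside (unclaimedClass c) u v ⊎ OtherNeighbourOutside (unclaimedClass c) v u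
      edge-into-class-guarded 3≤n {u} {v} cv uv with isLeaf G v Bool.≟ true
      ... | yes v-leaf =
        let w , w≢v , uw , claimed-w = support-claims 3≤n uv v-leaf
        in inj₁ (w , w≢v , uw , trans (cong (λ b → c w ∧ not b) claimed-w) (∧-zeroʳ (c w)))
      ... | no v-non-leaf =
        let w , w≢u , vw = non-leaf-other-neighbour (¬-not v-non-leaf) (adj-sym uv)
            cw≡cu = sym (proper-common-neighbour proper (adj-sym uv) vw)
        in inj₂ (w , w≢u , vw , cong (_∧ not (claimed w)) (trans cw≡cu cu≡false))
        where
        cu≡false : c u ≡ false
        cu≡false = ¬-not λ cu → proper u v uv (trans cu (sym cv))

      unclaimedClass-guarded : 3 ≤ n → EdgesGuarded (unclaimedClass c)
      unclaimedClass-guarded 3≤n {u} {v} uv with c v Bool.≟ true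
      ... | yes cv      = edge-into-class-guarded 3≤n cv uv
      ... | no  cv≢true = Sum.swap (edge-into-class-guarded 3≤n cu (adj-sym uv))
        where
        cu : c u ≡ true
        cu = ¬-not λ cu≡false → proper u v uv (trans cu≡false (sym (¬-not cv≢true)))

2*m≤m+n : ∀ {m n} → m ≤ n → 2 * m ≤ m + n
2*m≤m+n {m} {n} m≤n = subst (_≤ m + n) (cong (m +_) (sym (+-identityʳ m))) (+-monoʳ-≤ m m≤n)

smaller-half : {A : Set} (size : A → ℕ) {P : A → Set} {a b : A} → P a → P b →
               Σ A λ x → P x × 2 * size x ≤ size a + size b
smaller-half size {a = a} {b} Pa Pb with size a ≤? size b
... | yes a≤b = a , Pa , 2*m≤m+n a≤b
... | no  a≰b = b , Pb , subst (2 * size b ≤_) (+-comm (size b) (size a)) (2*m≤m+n (<⇒≤ (≰⇒> a≰b)))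

smallest-of-three : {A : Set} (size : A → ℕ) (P : A → Set) {N L s : ℕ} {a b d : A} →
                    P a → P b → P d → size a + size b ≤ N + L → size d + s ≤ N →
                    Σ A λ x → P x × (2 * size x ≤ N + L) × (size x + s ≤ N)
smallest-of-three size P {N} {L} {s} {d = d} Pa Pb Pd ab-bound d-bound = against-d (smaller-half size Pa Pb)
  where
  against-d : (Σ _ λ x → P x × 2 * size x ≤ _) →
              Σ _ λ x → P x × (2 * size x ≤ N + L) × (size x + s ≤ N)
  against-d (x , Px , x-half) with size x ≤? size d
  ... | yes x≤d = x , Px , ≤-trans x-half ab-bound , ≤-trans (+-monoˡ-≤ s x≤d) d-bound
  ... | no  x≰d = d , Pd , ≤-trans (*-monoʳ-≤ 2 (<⇒≤ (≰⇒> x≰d))) (≤-trans x-half ab-bound) , d-bound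

corollary7 : (n : ℕ) → 5 ≤ n → (G : Graph n) →
    Connected G → Bipartite G → NoTwinsDeg2 G →
    Σ (Fin n → Bool) λ C → IdentifyingCode G C ×
      (2 * count C ≤ n + numLeaves G) × (count C + numSupport G ≤ n)
corollary7 n 5≤n G connected (colour , proper) no-twins =
  smallest-of-three count (IdentifyingCode G) (class-code proper) (class-code (proper-not G proper)) leaves-code
    (class-codes-size G colour) (leaves-code-size G)
  where
  2≤n : 2 ≤ n
  2≤n = ≤-trans (s≤s (s≤s z≤n)) 5≤n
  3≤n : 3 ≤ n
  3≤n = ≤-trans (s≤s (s≤s (s≤s z≤n))) 5≤n
  identifying : {S : Fin n → Bool} → Independent G S → OpenTwinFree G S → EdgesGuarded G S →
                IdentifyingCode G (not ∘ S)
  identifying = complement-identifying G (bipartite⇒triangle-free G (colour , proper)) (has-neighbour G connected 2≤n)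
  class-code : {c : Fin n → Bool} → ProperColouring G c → IdentifyingCode G (not ∘ unclaimedClass G c)
  class-code c-proper = identifying (unclaimedClass-independent G connected c-proper)
                          (unclaimedClass-twin-free G connected c-proper 2≤n no-twins)
                          (unclaimedClass-guarded G connected c-proper 3≤n)
  leaves-code : IdentifyingCode G (not ∘ chosenLeaves G)
  leaves-code = identifying (chosenLeaves-independent G connected 3≤n) (chosenLeaves-twin-free G)
                            (chosenLeaves-guarded G connected 5≤n)
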